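{- Let $k,K\geq 2$ be integers and let $N=(K-1)(2K)^k$. For $0\le i\le k$ put $N_i=(2K)^{k-i}$. Then there is a decreasing sequence of sets \[A_k\subseteq A_{k-1}\subseteq \cdots\subseteq A_0=\{1,\ldots,N\}\] such that: (1) $|A_{i}|\geq (1-1/K)|A_{i-1}|$ for $1\le i\le k$; (2) for $1\le i\le k$, $A_i$ is a union of intervals $I_{i,j}$ (sets of integers of the form $[a,a+(K-1)N_i)\cap\mathbb{Z}$) of length $(K-1)N_i$; for $i=0$ set $I_{0,1}=A_0$, an interval of length $(K-1)N_0=N$; (3) for $0\le i\le k$, any $2$-regular subset of $A_i$ with more than $4K^2-4K$ elements is contained in a single interval $I_{i,j}$; (4) for $0\le i\le k$, any convex subset of $A_i$ has all but at most $i(2K^2-2K)$ of its elements in a single interval $I_{i,j}$.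
   Context: For $L\geq 1$, a finite increasing sequence of reals $a_1<\cdots<a_n$ (equivalently a finite set listed increasingly) is $L$-regular if there is a positive real $X$ with $X\leq a_{i+1}-a_i\leq LX$ for all $i=1,\ldots,n-1$. A finite increasing sequence is convex if its sequence of first differences $a_{i+1}-a_i$ is monotone. -}

module Defs where

open import Data.Nat as ℕ using (ℕ; _∸_; _≤_; _<_; _+_; _≤?_; _<?_)
open import Data.Integer using (+_)
open import Data.Rational as ℚ using (ℚ; _/_; 0ℚ)
open import Data.List using (List; []; _∷_)
open import Data.List.Relation.Unary.All using (All)
open import Data.List.Relation.Unary.Linked using (Linked)
open import Data.Product using (Σ; _×_)
open import Data.Sum using (_⊎_)
open import Relation.Nullary using (Dec)
open import Relation.Nullary.Decidable using (_×-dec_)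

ℕtoℚ : ℕ → ℚ
ℕtoℚ n = (+ n) / 1

-- first differences a_{i+1} - a_i of a list (exact subtraction for
-- strictly increasing lists, which is how we use it)
diffs : List ℕ → List ℕ
diffs (x ∷ y ∷ r) = (y ∸ x) ∷ diffs (y ∷ r)
diffs _ = []

-- a finite set of naturals listed increasingly
Increasing : List ℕ → Set
Increasing = Linked _<_

-- L-regular: exists positive X (rational; for integer data equivalent to real X,
-- e.g. X = minimum difference) with X ≤ a_{i+1}-a_i ≤ L X for all i
Regular : ℚ → List ℕ → Set
Regular L xs = Σ ℚ λ X → (0ℚ ℚ.< X) ×
  All (λ d → (X ℚ.≤ ℕtoℚ d) × (ℕtoℚ d ℚ.≤ L ℚ.* X)) (diffs xs)

Convex : List ℕ → Set
Convex xs = Linked ℕ._≤_ (diffs xs) ⊎ Linked ℕ._≥_ (diffs xs)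

InInterval : ℕ → ℕ → ℕ → Set
InInterval a len x = (a ≤ x) × (x < a + len)

inInterval? : ∀ a len x → Dec (InInterval a len x)
inInterval? a len x = (a ≤? x) ×-dec (x <? a + len)

-- A_i is a union of blocks of length (K-1)N_i whose left ends are K N_i apart, and every
-- block of A_i contains 2(K-1) blocks of A_{i+1}, one every K N_{i+1}. So distinct blocks of
-- A_{i+1} are separated by holes of length N_{i+1}, while a block of A_i has length
-- 2K(K-1) N_{i+1}. A sequence lying in one
-- block of A_i whose steps are all at most N_{i+1} stays in one block of A_{i+1}. Otherwise,
-- if it is 2-regular, all its steps exceed N_{i+1}/2, so it has at most 4K(K-1) elements. If
-- it is convex, its steps longer than N_{i+1} form an initial or a final segment, so the
-- elements outside one block of A_{i+1} are more than N_{i+1} apart and at most 2K(K-1) of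
-- them fit into the block of A_i.

module Submission where

open import Defs
open import Data.Nat using (ℕ; zero; suc; _∸_; _≤_; _<_; _≥_; _+_; _*_; _^_; z≤n; s≤s; s≤s⁻¹; _≤?_)
open import Data.Nat.Properties
open import Data.Nat.Tactic.RingSolver using (solve-∀)
open import Data.Integer using (+_)
import Data.Integer.Properties as ℤ
open import Data.Rational as ℚ using (_/_; mkℚ)
import Data.Rational.Properties as ℚ
open import Data.Nat.Coprimality using (1-coprimeTo) renaming (sym to coprime-sym)
open import Data.List using (List; []; _∷_; length; filter; concatMap; applyUpTo)
open import Data.List.Properties using (filter-accept; filter-reject; filter-≐; filter-none; length-applyUpTo; length-++)
open import Data.List.Relation.Unary.All as All using (All; []; _∷_; all?)
open import Data.List.Relation.Unary.All.Properties as All using (all-filter; ¬All⇒Any¬)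
open import Data.List.Relation.Unary.Any as Any using (Any; here; there)
open import Data.List.Relation.Unary.AllPairs as AllPairs using (AllPairs; []; _∷_)
import Data.List.Relation.Unary.AllPairs.Properties as AllPairs
open import Data.List.Relation.Unary.Linked as Linked using (Linked; []; [-]; _∷_)
open import Data.List.Relation.Unary.Linked.Properties using (Linked⇒All; Linked⇒AllPairs; AllPairs⇒Linked)
open import Data.List.Membership.Propositional using (_∈_; find; lose)
open import Data.List.Membership.Propositional.Properties
  using (∈-concatMap⁻; ∈-concatMap⁺; ∈-applyUpTo⁻; ∈-applyUpTo⁺)
open import Data.Product using (Σ; _×_; _,_; proj₁; proj₂; ∃-syntax)
open import Data.Sum using (_⊎_; inj₁; inj₂)
open import Data.Empty using (⊥-elim)
open import Function using (_⇔_; mk⇔; Equivalence)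
open import Relation.Nullary using (Dec; ¬_; ¬?; yes; no)
open import Relation.Nullary.Decidable using (_×-dec_)
open import Relation.Unary using (Decidable)
open import Relation.Unary.Properties using (_∩?_)
open import Relation.Binary.PropositionalEquality using (_≡_; refl; sym; trans; cong; cong₂; subst; module ≡-Reasoning)

module _ {A : Set} where

  length-filter-∷ : ∀ {P : A → Set} (P? : Decidable P) x xs →
    length (filter P? xs) ≤ length (filter P? (x ∷ xs))
  length-filter-∷ P? x xs with P? x
  ... | yes _ = n≤1+n _
  ... | no _ = ≤-refl

  module _ {P Q R : A → Set} (P? : Decidable P) (Q? : Decidable Q) (R? : Decidable R) where

    length-filter-∪ : (∀ {x} → P x → Q x ⊎ R x) → ∀ xs →
      length (filter P? xs) ≤ length (filter Q? xs) + length (filter R? xs)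
    length-filter-∪ split [] = z≤n
    length-filter-∪ split (x ∷ xs) with ih ← length-filter-∪ split xs | P? x
    ... | no _ = ≤-trans ih (+-mono-≤ (length-filter-∷ Q? x xs) (length-filter-∷ R? x xs))
    ... | yes p with split p
    ...   | inj₁ q rewrite filter-accept Q? {xs = xs} q =
            s≤s (≤-trans ih (+-monoʳ-≤ _ (length-filter-∷ R? x xs)))
    ...   | inj₂ r rewrite filter-accept R? {xs = xs} r
                         | +-suc (length (filter Q? (x ∷ xs))) (length (filter R? xs)) =
            s≤s (≤-trans ih (+-monoˡ-≤ _ (length-filter-∷ Q? x xs)))

  filter-∩ : ∀ {P Q : A → Set} (P? : Decidable P) (Q? : Decidable Q) xs →
    filter (P? ∩? Q?) xs ≡ filter P? (filter Q? xs)
  filter-∩ P? Q? [] = refl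
  filter-∩ P? Q? (x ∷ xs) with Q? x
  ... | no _ with P? x
  ...   | yes _ = filter-∩ P? Q? xs
  ...   | no _ = filter-∩ P? Q? xs
  filter-∩ P? Q? (x ∷ xs) | yes _ with P? x
  ...   | yes _ = cong (x ∷_) (filter-∩ P? Q? xs)
  ...   | no _ = filter-∩ P? Q? xs

  AllPairs-∈ : ∀ {R : A → A → Set} {xs a b} → AllPairs R xs → a ∈ xs → b ∈ xs →
    a ≡ b ⊎ R a b ⊎ R b a
  AllPairs-∈ _ (here refl) (here refl) = inj₁ refl
  AllPairs-∈ (r ∷ _) (here refl) (there q) = inj₂ (inj₁ (All.lookup r q))
  AllPairs-∈ (r ∷ _) (there p) (here refl) = inj₂ (inj₂ (All.lookup r p))
  AllPairs-∈ (_ ∷ rs) (there p) (there q) = AllPairs-∈ rs p q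

  AllPairs-concatMap⁺ : ∀ {R S : A → A → Set} {xs} (f : A → List A) →
    (∀ a → AllPairs R (f a)) → (∀ {a b} → S a b → All (λ x → All (R x) (f b)) (f a)) →
    AllPairs S xs → AllPairs R (concatMap f xs)
  AllPairs-concatMap⁺ f within between sep =
    AllPairs.concat⁺ (All.map⁺ (All.tabulate λ {a} _ → within a)) (AllPairs.map⁺ (AllPairs.map between sep))

  length-concatMap-const : ∀ {c} (f : A → List A) → (∀ a → length (f a) ≡ c) → ∀ xs →
    length (concatMap f xs) ≡ length xs * c
  length-concatMap-const f const [] = refl
  length-concatMap-const f const (a ∷ as) =
    trans (length-++ (f a)) (cong₂ _+_ (const a) (length-concatMap-const f const as))

  Linked⇒All-head : ∀ {R : A → A → Set} {x xs} → (∀ {a b c} → R a b → R b c → R a c) →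
    Linked R (x ∷ xs) → All (R x) xs
  Linked⇒All-head trans [-] = []
  Linked⇒All-head trans (r ∷ l) = Linked⇒All trans r l

*-suc-<⇒< : ∀ {n M D} → n * suc D < M * D → n < M
*-suc-<⇒< {n} {M} {D} lt = ≰⇒> λ M≤n →
  <-irrefl refl (<-≤-trans lt (≤-trans (*-monoˡ-≤ D M≤n) (*-monoʳ-≤ n (n≤1+n D))))

≤∸⇒+≤ : ∀ {a b D} → a ≤ b → D ≤ b ∸ a → a + D ≤ b
≤∸⇒+≤ {a} a≤b D≤b∸a = ≤-trans (+-monoʳ-≤ a D≤b∸a) (≤-reflexive (m+[n∸m]≡n a≤b))

m*[1+n]∸m≡m*n : ∀ m n → m * suc n ∸ m ≡ m * n
m*[1+n]∸m≡m*n m n = trans (cong (_∸ m) (*-suc m n)) (m+n∸m≡n m (m * n))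

Separated : ℕ → List ℕ → Set
Separated g = AllPairs (λ a b → a + g ≤ b)

linked-span : ∀ {f : ℕ → ℕ} {E H x xs} → Linked (λ a b → f a + E ≤ f b) (x ∷ xs) →
  All (λ y → f y < H) (x ∷ xs) → length xs * E + f x < H
linked-span [-] (fx<H ∷ []) = fx<H
linked-span {f} {E} {H} {x} {y ∷ ys} (step ∷ l) (_ ∷ bounds) = begin-strict
  length (y ∷ ys) * E + f x   ≡⟨ shift (length ys) E (f x) ⟩
  length ys * E + (f x + E)   ≤⟨ +-monoʳ-≤ (length ys * E) step ⟩
  length ys * E + f y         <⟨ linked-span l bounds ⟩
  H                           ∎
  where
  open ≤-Reasoning
  shift : ∀ n E u → suc n * E + u ≡ n * E + (u + E)
  shift = solve-∀

linked-capacity : ∀ {f : ℕ → ℕ} {D lo M xs} → Linked (λ a b → f a + suc D ≤ f b) xs →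
  All (λ y → lo ≤ f y × f y < lo + M * D) xs → length xs ≤ M
linked-capacity [] _ = z≤n
linked-capacity {f} {D} {lo} {M} {x ∷ xs} l bounds@((lo≤fx , _) ∷ _) =
  *-suc-<⇒< (+-cancelʳ-< lo (length xs * suc D) (M * D) (begin-strict
    length xs * suc D + lo    ≤⟨ +-monoʳ-≤ (length xs * suc D) lo≤fx ⟩
    length xs * suc D + f x   <⟨ linked-span l (All.map proj₂ bounds) ⟩
    lo + M * D                ≡⟨ +-comm lo (M * D) ⟩
    M * D + lo                ∎))
  where open ≤-Reasoning

separated-capacity : ∀ {D M lo len xs} → len ≡ M * D → Separated (suc D) xs →
  length (filter (inInterval? lo len) xs) ≤ M
separated-capacity {D} {M} {lo} {len} {xs} refl sep =
  linked-capacity (AllPairs⇒Linked (AllPairs.filter⁺ (inInterval? lo len) sep)) (all-filter (inInterval? lo len) xs)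

diffs-Linked : ∀ {P : ℕ → Set} {xs} → Increasing xs → All P (diffs xs) → Linked (λ a b → P (b ∸ a)) xs
diffs-Linked [] _ = []
diffs-Linked [-] _ = [-]
diffs-Linked (_ ∷ inc) (p ∷ ps) = p ∷ diffs-Linked inc ps

far-steps⇒separated : ∀ {D xs} → Increasing xs → All (D <_) (diffs xs) → Separated (suc D) xs
far-steps⇒separated {D} inc far = Linked⇒AllPairs gap-trans
  (Linked.map (λ (a<b , D<b∸a) → ≤∸⇒+≤ (<⇒≤ a<b) D<b∸a) (Linked.zip (inc , diffs-Linked inc far)))
  where
  gap-trans : ∀ {a b c} → a + suc D ≤ b → b + suc D ≤ c → a + suc D ≤ c
  gap-trans {b = b} ab bc = ≤-trans ab (≤-trans (m≤m+n b (suc D)) bc)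

ℕtoℚ≡mkℚ : ∀ n → ℕtoℚ n ≡ mkℚ (+ n) 0 (coprime-sym (1-coprimeTo n))
ℕtoℚ≡mkℚ n = ℚ.normalize-coprime (coprime-sym (1-coprimeTo n))

ℕtoℚ-cancel-≤ : ∀ {m n} → ℕtoℚ m ℚ.≤ ℕtoℚ n → m ≤ n
ℕtoℚ-cancel-≤ {m} {n} le rewrite ℕtoℚ≡mkℚ m | ℕtoℚ≡mkℚ n with ℚ.drop-*≤* le
... | le′ rewrite ℤ.*-identityʳ (+ m) | ℤ.*-identityʳ (+ n) = ℤ.drop‿+≤+ le′

2*ℕtoℚ : ∀ n → (+ 2 / 1) ℚ.* ℕtoℚ n ≡ ℕtoℚ (2 * n)
2*ℕtoℚ n rewrite ℕtoℚ≡mkℚ n = cong (_/ 1) (ℤ.+◃n≡+n (2 * n))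

regular-diffs : ∀ {xs d₀} → Regular (+ 2 / 1) xs → d₀ ∈ diffs xs → All (λ d → d₀ ≤ 2 * d) (diffs xs)
regular-diffs {d₀ = d₀} (X , _ , bounds) d₀∈ = All.map (λ {d} → half {d}) bounds
  where
  d₀≤2X : ℕtoℚ d₀ ℚ.≤ (+ 2 / 1) ℚ.* X
  d₀≤2X = proj₂ (All.lookup bounds d₀∈)
  half : ∀ {d} → (X ℚ.≤ ℕtoℚ d) × (ℕtoℚ d ℚ.≤ (+ 2 / 1) ℚ.* X) → d₀ ≤ 2 * d
  half {d} (X≤d , _) = ℕtoℚ-cancel-≤ {d₀} {2 * d} (ℚ.≤-trans d₀≤2X
    (subst ((+ 2 / 1) ℚ.* X ℚ.≤_) (2*ℕtoℚ d) (ℚ.*-monoˡ-≤-nonNeg (+ 2 / 1) X≤d)))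

regular-jump : ∀ {xs D} → Increasing xs → Regular (+ 2 / 1) xs → Any (D <_) (diffs xs) →
  Linked (λ a b → 2 * a + suc D ≤ 2 * b) xs
regular-jump {xs} {D} inc reg jump with d₀ , d₀∈ , D<d₀ ← find jump =
  Linked.map (λ {a} {b} → doubled) (Linked.zip (inc , diffs-Linked inc (regular-diffs reg d₀∈)))
  where
  doubled : ∀ {a b} → a < b × d₀ ≤ 2 * (b ∸ a) → 2 * a + suc D ≤ 2 * b
  doubled {a} {b} (a<b , d₀≤) = ≤∸⇒+≤ (*-monoʳ-≤ 2 (<⇒≤ a<b))
    (≤-trans D<d₀ (≤-trans d₀≤ (≤-reflexive (*-distribˡ-∸ 2 b a))))

module Blocks (len : ℕ) (starts : List ℕ) where

  InBlock : ℕ → ℕ → Set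
  InBlock a = InInterval a len

  block : ℕ → List ℕ
  block a = applyUpTo (λ i → a + i) len

  ∈-block⁻ : ∀ {a x} → x ∈ block a → InBlock a x
  ∈-block⁻ {a} p with i , i<len , refl ← ∈-applyUpTo⁻ (λ i → a + i) p = m≤m+n a i , +-monoʳ-< a i<len

  ∈-block⁺ : ∀ {a x} → InBlock a x → x ∈ block a
  ∈-block⁺ {a} {x} (a≤x , x<a+len) = subst (_∈ block a) (m+[n∸m]≡n a≤x)
    (∈-applyUpTo⁺ (λ i → a + i)
      (+-cancelˡ-< a (x ∸ a) len (subst (_< a + len) (sym (m+[n∸m]≡n a≤x)) x<a+len)))

  union : List ℕ
  union = concatMap block starts

  ∈-union⇔ : ∀ x → x ∈ union ⇔ (∃[ a ] (a ∈ starts × InBlock a x))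
  ∈-union⇔ x = mk⇔
    (λ x∈ → let a , a∈ , x∈a = find (∈-concatMap⁻ block x∈) in a , a∈ , ∈-block⁻ x∈a)
    (λ (a , a∈ , x∈a) → ∈-concatMap⁺ block (lose a∈ (∈-block⁺ x∈a)))

  length-union : length union ≡ length starts * len
  length-union = length-concatMap-const block (λ a → length-applyUpTo (λ i → a + i) len) starts

  SameBlock : ℕ → ℕ → Set
  SameBlock x y = Any (λ a → InBlock a x × InBlock a y) starts

  sameBlock? : ∀ x y → Dec (SameBlock x y)
  sameBlock? x y = Any.any? (λ a → inInterval? a len x ×-dec inInterval? a len y) starts

  otherBlock? : ∀ z w → Dec (¬ SameBlock z w)
  otherBlock? z w = ¬? (sameBlock? z w)

  sameBlock-refl : ∀ {x} → x ∈ union → SameBlock x x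
  sameBlock-refl {x} x∈ with a , a∈ , x∈a ← Equivalence.to (∈-union⇔ x) x∈ = lose a∈ (x∈a , x∈a)

  sameBlock-sym : ∀ {x y} → SameBlock x y → SameBlock y x
  sameBlock-sym = Any.map λ (x∈a , y∈a) → y∈a , x∈a

  module Gapped (gap : ℕ) (separated : Separated (gap + len) starts) where

    block-end-≤ : ∀ a → a + len ≤ a + (gap + len)
    block-end-≤ a = +-monoʳ-≤ a (m≤n+m len gap)

    start-unique : ∀ {a b x} → a ∈ starts → b ∈ starts → InBlock a x → InBlock b x → a ≡ b
    start-unique {a} {b} a∈ b∈ (a≤x , x<a+len) (b≤x , x<b+len) with AllPairs-∈ separated a∈ b∈
    ... | inj₁ a≡b = a≡b
    ... | inj₂ (inj₁ a⋯b) = ⊥-elim (<⇒≱ x<a+len (≤-trans (block-end-≤ a) (≤-trans a⋯b b≤x)))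
    ... | inj₂ (inj₂ b⋯a) = ⊥-elim (<⇒≱ x<b+len (≤-trans (block-end-≤ b) (≤-trans b⋯a a≤x)))

    sameBlock-inBlock : ∀ {a x y} → a ∈ starts → InBlock a x → SameBlock x y → InBlock a y
    sameBlock-inBlock a∈ x∈a xy with b , b∈ , (x∈b , y∈b) ← find xy
      rewrite start-unique a∈ b∈ x∈a x∈b = y∈b

    sameBlock-trans : ∀ {x y z} → SameBlock x y → SameBlock y z → SameBlock x z
    sameBlock-trans xy yz with a , a∈ , (x∈a , y∈a) ← find xy = lose a∈ (x∈a , sameBlock-inBlock a∈ y∈a yz)

    near⇒sameBlock : ∀ {x y} → x ∈ union → y ∈ union → x ≤ y → y ∸ x ≤ gap → SameBlock x y
    near⇒sameBlock {x} {y} x∈ y∈ x≤y y∸x≤gap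
      with a , a∈ , (a≤x , x<a+len) ← Equivalence.to (∈-union⇔ x) x∈
         | b , b∈ , (b≤y , y<b+len) ← Equivalence.to (∈-union⇔ y) y∈
         | AllPairs-∈ separated a∈ b∈
    ... | inj₁ refl = lose a∈ ((a≤x , x<a+len) , (b≤y , y<b+len))
    ... | inj₂ (inj₁ a⋯b) = ⊥-elim (<⇒≱ (begin-strict
          x + gap          <⟨ +-monoˡ-< gap x<a+len ⟩
          a + len + gap    ≡⟨ trans (+-assoc a len gap) (cong (λ n → a + n) (+-comm len gap)) ⟩
          a + (gap + len)  ≤⟨ a⋯b ⟩
          b                ≤⟨ b≤y ⟩
          y                ∎) y≤x+gap)
      where
      open ≤-Reasoning
      y≤x+gap : y ≤ x + gap
      y≤x+gap = subst (_≤ x + gap) (m+[n∸m]≡n x≤y) (+-monoʳ-≤ x y∸x≤gap)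
    ... | inj₂ (inj₂ b⋯a) =
          ⊥-elim (<⇒≱ y<b+len (≤-trans (block-end-≤ b) (≤-trans b⋯a (≤-trans a≤x x≤y))))

    union-increasing : Increasing union
    union-increasing = AllPairs⇒Linked (AllPairs-concatMap⁺ block within between separated)
      where
      within : ∀ a → AllPairs _<_ (block a)
      within a = AllPairs.applyUpTo⁺₁ (λ i → a + i) len (λ i<j _ → +-monoʳ-< a i<j)
      between : ∀ {a b} → a + (gap + len) ≤ b → All (λ x → All (x <_) (block b)) (block a)
      between {a} a⋯b = All.tabulate λ x∈a → All.tabulate λ y∈b →
        <-≤-trans (proj₂ (∈-block⁻ x∈a))
          (≤-trans (block-end-≤ a) (≤-trans a⋯b (proj₁ (∈-block⁻ y∈b))))

    sameBlock-steps : ∀ {x xs} → Increasing (x ∷ xs) → All (_∈ union) (x ∷ xs) →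
      All (_≤ gap) (diffs (x ∷ xs)) → All (SameBlock x) (x ∷ xs)
    sameBlock-steps {x} {[]} _ (x∈ ∷ []) [] = sameBlock-refl x∈ ∷ []
    sameBlock-steps {x} {y ∷ ys} (x<y ∷ inc) (x∈ ∷ ys∈) (near ∷ small) =
      sameBlock-refl x∈ ∷ All.map (sameBlock-trans (near⇒sameBlock x∈ (All.head ys∈) (<⇒≤ x<y) near))
                                  (sameBlock-steps inc ys∈ small)

    sameBlock-or-jump : ∀ {x xs} → Increasing (x ∷ xs) → All (_∈ union) (x ∷ xs) →
      All (SameBlock x) (x ∷ xs) ⊎ Any (gap <_) (diffs (x ∷ xs))
    sameBlock-or-jump {x} {xs} inc cov with all? (_≤? gap) (diffs (x ∷ xs))
    ... | yes small = inj₁ (sameBlock-steps inc cov small)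
    ... | no ¬small = inj₂ (Any.map ≰⇒> (¬All⇒Any¬ (_≤? gap) (diffs (x ∷ xs)) ¬small))

    outsideBlockOf : ℕ → List ℕ → List ℕ
    outsideBlockOf z = filter (otherBlock? z)

    outsideBlockOf-self : ∀ {x xs} → x ∈ union → outsideBlockOf x (x ∷ xs) ≡ outsideBlockOf x xs
    outsideBlockOf-self x∈ = filter-reject (otherBlock? _) (λ ¬same → ¬same (sameBlock-refl x∈))

    outsideBlockOf-cong : ∀ {x y} → SameBlock x y → ∀ xs → outsideBlockOf x xs ≡ outsideBlockOf y xs
    outsideBlockOf-cong xy = filter-≐ (otherBlock? _) (otherBlock? _)
      ((λ ¬xw yw → ¬xw (sameBlock-trans xy yw)) , (λ ¬yw xw → ¬yw (sameBlock-trans (sameBlock-sym xy) xw)))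

    outsideBlockOf-up : ∀ {x xs} → Increasing (x ∷ xs) → Linked _≤_ (diffs (x ∷ xs)) →
      All (_∈ union) (x ∷ xs) → Separated (suc gap) (outsideBlockOf x xs)
    outsideBlockOf-up {x} {[]} _ _ _ = []
    outsideBlockOf-up {x} {y ∷ ys} (x<y ∷ inc) up (x∈ ∷ ys∈) with y ∸ x ≤? gap
    ... | yes near rewrite outsideBlockOf-cong (near⇒sameBlock x∈ (All.head ys∈) (<⇒≤ x<y) near) (y ∷ ys)
                         | outsideBlockOf-self {xs = ys} (All.head ys∈) =
          outsideBlockOf-up inc (Linked.tail up) ys∈
    ... | no far = AllPairs.filter⁺ (otherBlock? x)
          (far-steps⇒separated inc (All.map (<-≤-trans (≰⇒> far)) (Linked⇒All-head ≤-trans up)))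

    outsideBlockOf-down : ∀ {x xs} → Increasing (x ∷ xs) → Linked _≥_ (diffs (x ∷ xs)) →
      All (_∈ union) (x ∷ xs) → ∃[ z ] (z ∈ union × Separated (suc gap) (outsideBlockOf z (x ∷ xs)))
    outsideBlockOf-down {x} {[]} _ _ (x∈ ∷ []) = x , x∈ , subst (Separated (suc gap)) (sym (outsideBlockOf-self x∈)) []
    outsideBlockOf-down {x} {y ∷ ys} inc@(x<y ∷ inc′) down cov@(x∈ ∷ ys∈) with y ∸ x ≤? gap
    ... | yes near = x , x∈ , subst (Separated (suc gap)) (sym none-outside) []
      where
      all-same : All (SameBlock x) (x ∷ y ∷ ys)
      all-same = sameBlock-steps inc cov
        (near ∷ All.map (λ d≤ → ≤-trans d≤ near) (Linked⇒All-head (λ p q → ≤-trans q p) down))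
      none-outside : outsideBlockOf x (x ∷ y ∷ ys) ≡ []
      none-outside = filter-none (otherBlock? x) (All.map (λ same ¬same → ¬same same) all-same)
    ... | no far with z , z∈ , sep ← outsideBlockOf-down inc′ (Linked.tail down) ys∈ = z , z∈ , extend
      where
      x⋯rest : All (λ w → x + suc gap ≤ w) (outsideBlockOf z (y ∷ ys))
      x⋯rest = All.filter⁺ (otherBlock? z) (All.map (≤-trans (≤∸⇒+≤ (<⇒≤ x<y) (≰⇒> far)))
        (≤-refl ∷ All.map <⇒≤ (Linked⇒All-head <-trans inc′)))
      extend : Separated (suc gap) (outsideBlockOf z (x ∷ y ∷ ys))
      extend with sameBlock? z x
      ... | yes _ = sep
      ... | no _ = x⋯rest ∷ sep

    -- z is the first element if the steps increase; if they decrease, it is the first element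
    -- from which all steps are at most gap.
    convex-outsideBlock : ∀ {x xs} → Increasing (x ∷ xs) → Convex (x ∷ xs) → All (_∈ union) (x ∷ xs) →
      ∃[ z ] (z ∈ union × Separated (suc gap) (outsideBlockOf z (x ∷ xs)))
    convex-outsideBlock {x} inc (inj₁ up) cov@(x∈ ∷ _) =
      x , x∈ , subst (Separated (suc gap)) (sym (outsideBlockOf-self x∈)) (outsideBlockOf-up inc up cov)
    convex-outsideBlock inc (inj₂ down) cov = outsideBlockOf-down inc down cov

module Construction (k m : ℕ) where

  κ : ℕ
  κ = suc m

  K : ℕ
  K = suc κ

  N : ℕ → ℕ
  N i = (2 * K) ^ (k ∸ i)

  L : ℕ → ℕ
  L i = κ * N i

  N-step : ∀ {i} → i < k → N i ≡ 2 * K * N (suc i)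
  N-step i<k = cong ((2 * K) ^_) (+-∸-assoc 1 i<k)

  children : ℕ → ℕ → List ℕ
  children i a = applyUpTo (λ t → a + t * (K * N (suc i))) (2 * κ)

  starts : ℕ → List ℕ
  starts zero = 1 ∷ []
  starts (suc i) = concatMap (children i) (starts i)

  A : ℕ → List ℕ
  A i = Blocks.union (L i) (starts i)

  ∈-starts-suc⁻ : ∀ {i b} → b ∈ starts (suc i) →
    ∃[ a ] (a ∈ starts i × ∃[ t ] (t < 2 * κ × b ≡ a + t * (K * N (suc i))))
  ∈-starts-suc⁻ {i} b∈ with a , a∈ , b∈a ← find (∈-concatMap⁻ (children i) b∈) =
    a , a∈ , ∈-applyUpTo⁻ _ b∈a

  first-child∈starts : ∀ {i a} → a ∈ starts i → a ∈ starts (suc i)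
  first-child∈starts {i} {a} a∈ = ∈-concatMap⁺ (children i) (lose a∈ (here (sym (+-identityʳ a))))

  children-span : ∀ {t} → t < 2 * κ → ∀ n → suc t * (K * n) ≤ K * (2 * K * n)
  children-span {t} t<2κ n = begin
    suc t * (K * n)    ≤⟨ *-monoˡ-≤ (K * n) (≤-trans t<2κ (*-monoʳ-≤ 2 (n≤1+n κ))) ⟩
    2 * K * (K * n)    ≡⟨ reorder K n ⟩
    K * (2 * K * n)    ∎
    where
    open ≤-Reasoning
    reorder : ∀ K n → 2 * K * (K * n) ≡ K * (2 * K * n)
    reorder = solve-∀

  child-block-end : ∀ {t} → t < 2 * κ → ∀ n → t * (K * n) + κ * n ≤ κ * (2 * K * n)
  child-block-end {t} t<2κ n = begin
    t * (K * n) + κ * n   ≤⟨ +-monoʳ-≤ (t * (K * n)) (*-monoˡ-≤ n (n≤1+n κ)) ⟩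
    t * (K * n) + K * n   ≡⟨ +-comm (t * (K * n)) (K * n) ⟩
    suc t * (K * n)       ≤⟨ *-monoˡ-≤ (K * n) t<2κ ⟩
    2 * κ * (K * n)       ≡⟨ reorder κ n ⟩
    κ * (2 * K * n)       ∎
    where
    open ≤-Reasoning
    reorder : ∀ κ n → 2 * κ * (suc κ * n) ≡ κ * (2 * suc κ * n)
    reorder = solve-∀

  starts-separated : ∀ {i} → i ≤ k → Separated (K * N i) (starts i)
  starts-separated {zero} _ = [] ∷ []
  starts-separated {suc i} i<k =
    AllPairs-concatMap⁺ (children i) within between (starts-separated (<⇒≤ i<k))
    where
    G = K * N (suc i)
    next-child : ∀ a s → a + s * G + G ≡ a + suc s * G
    next-child a s = trans (+-assoc a (s * G) G) (cong (λ n → a + n) (+-comm (s * G) G))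
    within : ∀ a → Separated G (children i a)
    within a = AllPairs.applyUpTo⁺₁ (λ t → a + t * G) (2 * κ) λ {s} {t} s<t _ →
      subst (_≤ a + t * G) (sym (next-child a s)) (+-monoʳ-≤ a (*-monoˡ-≤ G s<t))
    between : ∀ {a b} → a + K * N i ≤ b →
      All (λ c → All (λ d → c + G ≤ d) (children i b)) (children i a)
    between {a} {b} a⋯b = All.applyUpTo⁺₁ (λ s → a + s * G) (2 * κ) λ {s} s<2κ →
                          All.applyUpTo⁺₁ (λ t → b + t * G) (2 * κ) λ {t} _ → begin
      a + s * G + G                 ≡⟨ next-child a s ⟩
      a + suc s * G                 ≤⟨ +-monoʳ-≤ a (children-span s<2κ (N (suc i))) ⟩
      a + K * (2 * K * N (suc i))   ≡⟨ cong (λ n → a + K * n) (sym (N-step i<k)) ⟩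
      a + K * N i                   ≤⟨ a⋯b ⟩
      b                             ≤⟨ m≤m+n b (t * G) ⟩
      b + t * G                     ∎
      where open ≤-Reasoning

  A-nested : ∀ {i x} → i < k → x ∈ A (suc i) → x ∈ A i
  A-nested {i} {x} i<k x∈
    with b , b∈ , (b≤x , x<b+L) ← Equivalence.to (Blocks.∈-union⇔ (L (suc i)) (starts (suc i)) x) x∈
    with a , a∈ , t , t<2κ , refl ← ∈-starts-suc⁻ {i} b∈ =
    Equivalence.from (Blocks.∈-union⇔ (L i) (starts i) x) (a , a∈ , ≤-trans (m≤m+n a _) b≤x , x<a+L)
    where
    open ≤-Reasoning
    x<a+L : x < a + L i
    x<a+L = begin-strict
      x                                         <⟨ x<b+L ⟩
      a + t * (K * N (suc i)) + L (suc i)       ≡⟨ +-assoc a _ _ ⟩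
      a + (t * (K * N (suc i)) + L (suc i))     ≤⟨ +-monoʳ-≤ a (child-block-end t<2κ (N (suc i))) ⟩
      a + κ * (2 * K * N (suc i))               ≡⟨ cong (λ n → a + κ * n) (sym (N-step i<k)) ⟩
      a + L i                                   ∎

  length-starts-suc : ∀ i → length (starts (suc i)) ≡ length (starts i) * (2 * κ)
  length-starts-suc i = length-concatMap-const (children i)
    (λ a → length-applyUpTo (λ t → a + t * (K * N (suc i))) (2 * κ)) (starts i)

  length-A-step : ∀ {i} → i < k → κ * length (A i) ≡ K * length (A (suc i))
  length-A-step {i} i<k = begin
    κ * length (A i)
      ≡⟨ cong (κ *_) (Blocks.length-union (L i) (starts i)) ⟩
    κ * (length (starts i) * (κ * N i))
      ≡⟨ cong (λ n → κ * (length (starts i) * (κ * n))) (N-step i<k) ⟩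
    κ * (length (starts i) * (κ * (2 * K * N (suc i))))
      ≡⟨ regroup κ (length (starts i)) (N (suc i)) ⟩
    K * (length (starts i) * (2 * κ) * L (suc i))
      ≡⟨ cong (λ n → K * (n * L (suc i))) (length-starts-suc i) ⟨
    K * (length (starts (suc i)) * L (suc i))
      ≡⟨ cong (K *_) (Blocks.length-union (L (suc i)) (starts (suc i))) ⟨
    K * length (A (suc i))
      ∎
    where
    open ≡-Reasoning
    regroup : ∀ κ s n → κ * (s * (κ * (2 * suc κ * n))) ≡ suc κ * (s * (2 * κ) * (κ * n))
    regroup = solve-∀

  module Level {i} (i≤k : i ≤ k) where
    open Blocks (L i) (starts i) public
    open Gapped (N i) (starts-separated i≤k) public

  L-step : ∀ {j} → j < k → L j ≡ 2 * K * κ * N (suc j)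
  L-step {j} j<k = trans (cong (κ *_) (N-step j<k)) (regroup κ (N (suc j)))
    where
    regroup : ∀ κ n → κ * (2 * suc κ * n) ≡ 2 * suc κ * κ * n
    regroup = solve-∀

  RegularInBlock : ℕ → Set
  RegularInBlock i = (S : List ℕ) → Increasing S → All (λ x → x ∈ A i) S →
    Regular ((+ 2) / 1) S → 4 * K * κ < length S →
    ∃[ a ] ((a ∈ starts i) × All (InInterval a (L i)) S)

  ConvexInBlock : ℕ → Set
  ConvexInBlock i = (S : List ℕ) → Increasing S → All (λ x → x ∈ A i) S → Convex S →
    ∃[ a ] ((a ∈ starts i) × (length (filter (λ x → ¬? (inInterval? a (L i) x)) S) ≤ i * (2 * K * κ)))

  A₀⊆block : ∀ {x} → x ∈ A 0 → InInterval 1 (L 0) x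
  A₀⊆block {x} x∈ with _ , here refl , x∈1 ← Equivalence.to (Blocks.∈-union⇔ (L 0) (starts 0) x) x∈ = x∈1

  regular-level₀ : RegularInBlock 0
  regular-level₀ S _ cov _ _ = 1 , here refl , All.map A₀⊆block cov

  convex-level₀ : ConvexInBlock 0
  convex-level₀ S _ cov _ = 1 , here refl ,
    ≤-reflexive (cong length
      (filter-none (λ x → ¬? (inInterval? 1 (L 0) x)) (All.map (λ x∈ ¬in → ¬in (A₀⊆block x∈)) cov)))

  regular-step : ∀ {j} → j < k → RegularInBlock j → RegularInBlock (suc j)
  regular-step j<k ih [] _ _ _ ()
  regular-step {j} j<k ih S@(x ∷ _) inc cov reg big
    with a , a∈ , inJ ← ih S inc (All.map (A-nested j<k) cov) reg big
    with Level.sameBlock-or-jump j<k inc cov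
  ... | inj₁ same with b , b∈ , x∈b ← Equivalence.to (Level.∈-union⇔ j<k x) (All.head cov) =
        b , b∈ , All.map (Level.sameBlock-inBlock j<k b∈ x∈b) same
  ... | inj₂ jump = ⊥-elim (<⇒≱ big (linked-capacity (regular-jump inc reg jump) (All.map doubled inJ)))
    where
    doubled : ∀ {y} → InInterval a (L j) y → 2 * a ≤ 2 * y × 2 * y < 2 * a + 4 * K * κ * N (suc j)
    doubled (a≤y , y<a+L) = *-monoʳ-≤ 2 a≤y , <-≤-trans (*-monoʳ-< 2 y<a+L) (≤-reflexive (begin
      2 * (a + L j)                    ≡⟨ *-distribˡ-+ 2 a (L j) ⟩
      2 * a + 2 * L j                  ≡⟨ cong (λ n → 2 * a + 2 * n) (L-step j<k) ⟩
      2 * a + 2 * (2 * K * κ * N (suc j)) ≡⟨ cong (λ n → 2 * a + n) (regroup K κ (N (suc j))) ⟩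
      2 * a + 4 * K * κ * N (suc j)    ∎))
      where
      open ≡-Reasoning
      regroup : ∀ K κ n → 2 * (2 * K * κ * n) ≡ 4 * K * κ * n
      regroup = solve-∀

  convex-step : ∀ {j} → j < k → ConvexInBlock j → ConvexInBlock (suc j)
  convex-step {j} j<k ih [] inc _ cv with a , a∈ , _ ← ih [] inc [] cv = a , first-child∈starts {j} a∈ , z≤n
  convex-step {j} j<k ih S@(_ ∷ _) inc cov cv
    with a , a∈ , few-outside-a ← ih S inc (All.map (A-nested j<k) cov) cv
       | z , z∈ , separated ← Level.convex-outsideBlock j<k inc cv cov
    with b , b∈ , z∈b ← Equivalence.to (Level.∈-union⇔ j<k z) z∈ = b , b∈ , (begin
      # outside-b? S
        ≤⟨ length-filter-∪ outside-b? outside-a? (inside-a? ∩? apart-z?) split S ⟩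
      # outside-a? S + # (inside-a? ∩? apart-z?) S
        ≡⟨ cong (λ xs → # outside-a? S + length xs) (filter-∩ inside-a? apart-z? S) ⟩
      # outside-a? S + # inside-a? (filter apart-z? S)
        ≤⟨ +-mono-≤ few-outside-a (separated-capacity (L-step j<k) separated) ⟩
      j * (2 * K * κ) + 2 * K * κ
        ≡⟨ +-comm (j * (2 * K * κ)) (2 * K * κ) ⟩
      suc j * (2 * K * κ)
        ∎)
    where
    open ≤-Reasoning
    # : ∀ {P : ℕ → Set} → Decidable P → List ℕ → ℕ
    # P? xs = length (filter P? xs)
    outside-b? = λ x → ¬? (inInterval? b (L (suc j)) x)
    outside-a? = λ x → ¬? (inInterval? a (L j) x)
    inside-a? = inInterval? a (L j)
    apart-z? = Level.otherBlock? j<k z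
    split : ∀ {x} → ¬ InInterval b (L (suc j)) x →
      ¬ InInterval a (L j) x ⊎ (InInterval a (L j) x × ¬ Level.SameBlock j<k z x)
    split {x} ∉b with inside-a? x
    ... | no ∉a = inj₁ ∉a
    ... | yes ∈a = inj₂ (∈a , λ same → ∉b (Level.sameBlock-inBlock j<k b∈ z∈b same))

  levels : ∀ {i} → i ≤ k → RegularInBlock i × ConvexInBlock i
  levels {zero} _ = regular-level₀ , convex-level₀
  levels {suc j} j<k with regular , convex ← levels (<⇒≤ j<k) = regular-step j<k regular , convex-step j<k convex

lemma4 : (k K : ℕ) → 2 ≤ k → 2 ≤ K →
    Σ (ℕ → List ℕ) λ A → Σ (ℕ → List ℕ) λ st →
      (∀ i → i ≤ k → Increasing (A i))
      × (∀ x → x ∈ A 0 ⇔ ((1 ≤ x) × (x ≤ (K ∸ 1) * (2 * K) ^ k)))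
      × (∀ i → 1 ≤ i → i ≤ k → All (λ x → x ∈ A (i ∸ 1)) (A i))
      × (∀ i → 1 ≤ i → i ≤ k → (K ∸ 1) * length (A (i ∸ 1)) ≤ K * length (A i))
      × (st 0 ≡ 1 ∷ [])
      × (∀ i → i ≤ k → ∀ x →
          x ∈ A i ⇔ (∃[ a ] ((a ∈ st i) × InInterval a ((K ∸ 1) * (2 * K) ^ (k ∸ i)) x)))
      × (∀ i → i ≤ k → (S : List ℕ) → Increasing S → All (λ x → x ∈ A i) S →
          Regular ((+ 2) / 1) S → 4 * K * K ∸ 4 * K < length S →
          ∃[ a ] ((a ∈ st i) × All (InInterval a ((K ∸ 1) * (2 * K) ^ (k ∸ i))) S))
      × (∀ i → i ≤ k → (S : List ℕ) → Increasing S → All (λ x → x ∈ A i) S →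
          Convex S →
          ∃[ a ] ((a ∈ st i) ×
            (length (filter (λ x → ¬? (inInterval? a ((K ∸ 1) * (2 * K) ^ (k ∸ i)) x)) S)
              ≤ i * (2 * K * K ∸ 2 * K))))
lemma4 k (suc (suc m)) _ (s≤s (s≤s z≤n)) =
  A , starts , (λ _ → Level.union-increasing) , A₀-interval , nested , shrinking , refl ,
  (λ i _ → Blocks.∈-union⇔ (L i) (starts i)) ,
  (λ i i≤k S inc cov reg big →
    proj₁ (levels i≤k) S inc cov reg (subst (_< length S) (m*[1+n]∸m≡m*n (4 * K) κ) big)) ,
  (λ i i≤k S inc cov cv → let a , a∈ , few = proj₂ (levels i≤k) S inc cov cv in
    a , a∈ , subst (λ c → length (filter (λ x → ¬? (inInterval? a (L i) x)) S) ≤ i * c)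
                   (sym (m*[1+n]∸m≡m*n (2 * K) κ)) few)
  where
  open Construction k m
  A₀-interval : ∀ x → x ∈ A 0 ⇔ ((1 ≤ x) × (x ≤ κ * N 0))
  A₀-interval x = mk⇔
    (λ x∈ → let 1≤x , x<1+L = A₀⊆block x∈ in 1≤x , s≤s⁻¹ x<1+L)
    (λ (1≤x , x≤L) → Equivalence.from (Blocks.∈-union⇔ (L 0) (starts 0) x) (1 , here refl , 1≤x , s≤s x≤L))
  nested : ∀ i → 1 ≤ i → i ≤ k → All (λ x → x ∈ A (i ∸ 1)) (A i)
  nested (suc j) _ j<k = All.tabulate (A-nested j<k)
  shrinking : ∀ i → 1 ≤ i → i ≤ k → κ * length (A (i ∸ 1)) ≤ K * length (A i)
  shrinking (suc j) _ j<k = ≤-reflexive (length-A-step j<k)
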